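{- Let $K\in\mathcal{T}_{\mathrm{blind}}^{\mathrm{nodist}}$ and let $\mathcal{A}$ be the following algorithm run with knowledge $K$: set $h:=1$; repeat: perform $DFS_h$; let $k:=\min\{i\in\mathbb{N}: i\ge h+1 \text{ and } L_{h+1}^{i}\ge L_1^h\}$; if $L_{h+1}^{k}\ge 3L_1^h$ and $k\ge h+2$ then set $h:=k-1$, otherwise set $h:=k$. Then for every instance $(T,d)\in K$, $C_{\mathcal{A}}^K(T,d)\le 16\,L_1^d(T)$.
   Context: Treasure hunt in trees. A tree is a finite tree rooted at the starting node of a mobile agent; at each node of degree $\delta$ the incident edges carry port numbers $0,\dots,\delta-1$, assigned arbitrarily. $h(T)$ is the depth of $T$. The $i$th level of $T$ is the set of nodes at distance $i$ from the root; $l_i(T)$ is the number of nodes at level $i$ and $L_{a}^{b}(T)=\sum_{i=a}^{b} l_i(T)$ (these depend only on the unlabeled rooted tree, so are computable from the blind map; in the algorithm they refer to the tree in $K$). An instance is a pair $(T,d)$ with $T$ a tree and $1\le d\le h(T)$. $\mathcal{T}_{\mathrm{blind}}^{\mathrm{nodist}}$ is the family of all knowledges of the form $K=\{(T,d): T\in P(T^*), 1\le d\le h(T^*)\}$, where $T^*$ is a tree and $P(T^*)$ is the set of trees obtained from $T^*$ by reassigning arbitrary port numbers at each node (i.e. the agent knows the tree without port numbers and not the distance). $DFS_h$ denotes a depth-first traversal starting at the root that visits all nodes at levels at most $h$, visiting children in increasing order of port numbers at each node, and returns to the root. A deterministic algorithm starts at the root, at each step sees the port numbers at its current node, chooses one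 based on its history, traverses that edge and learns the entry port and the degree of the new node. The cost $C_{\mathcal{A}}^K(T,d)$ is the total number of edge traversals (including revisits) made by $\mathcal{A}$ in $T$ with knowledge $K$ until all nodes at distance exactly $d$ from the root have been visited. -}

module Defs where

open import Data.Nat using (ℕ; zero; suc; _+_; _*_; _∸_; _≤ᵇ_; _⊔_)
open import Data.Nat.ListAction using (sum)
open import Data.Bool using (Bool; true; false; if_then_else_; _∧_)
open import Data.Maybe using (Maybe; just; nothing)
open import Data.Product using (_×_; _,_; proj₁; proj₂)
open import Data.List using (List; []; _∷_; [_]; _++_; map; length; upTo; concatMap)
open import Data.List.Relation.Unary.All using (All)
open import Data.List.Relation.Binary.Pointwise using (Pointwise)
open import Data.List.Relation.Binary.Permutation.Propositional using (_↭_)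

-- Unlabeled rooted trees (the "blind map").  The order of the children
-- list carries no meaning; trees are compared up to isomorphism _≅_.

data Tree : Set where
  node : List Tree → Tree

data _≅_ : Tree → Tree → Set where
  iso : ∀ {cs es ds} → cs ↭ es → Pointwise _≅_ es ds → node cs ≅ node ds

mutual
  level : ℕ → Tree → ℕ
  level zero    _         = 1
  level (suc i) (node cs) = levelList i cs

  levelList : ℕ → List Tree → ℕ
  levelList i []       = 0
  levelList i (c ∷ cs) = level i c + levelList i cs

mutual
  height : Tree → ℕ
  height (node []) = 0
  height (node (c ∷ cs)) = suc (heightList (c ∷ cs))

  heightList : List Tree → ℕ
  heightList []       = 0
  heightList (c ∷ cs) = height c ⊔ heightList cs

-- L_a^b(T) = Σ_{i=a}^{b} l_i(T)  (= 0 when b < a)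
L : Tree → ℕ → ℕ → ℕ
L t a b = sum (map (λ j → level (a + j) t) (upTo (suc b ∸ a)))

-- Port-labeled trees.  A node is given by the list of its children; each
-- entry (p , q , c) says: the edge to child c has port p at this node and
-- port q at c.

data PTree : Set where
  pnode : List (ℕ × ℕ × PTree) → PTree

childPorts : List (ℕ × ℕ × PTree) → List ℕ
childPorts = map proj₁

-- Valid mp t : the ports at every node of t are exactly 0,…,δ-1 (δ the
-- degree).  mp = nothing for the root, mp = just q for a non-root node
-- whose port toward its parent is q.
data Valid : Maybe ℕ → PTree → Set where
  validRoot : ∀ {cs} → childPorts cs ↭ upTo (length cs) →
              All (λ e → Valid (just (proj₁ (proj₂ e))) (proj₂ (proj₂ e))) cs →
              Valid nothing (pnode cs)
  validInner : ∀ {q cs} → q ∷ childPorts cs ↭ upTo (suc (length cs)) →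
              All (λ e → Valid (just (proj₁ (proj₂ e))) (proj₂ (proj₂ e))) cs →
              Valid (just q) (pnode cs)

mutual
  forget : PTree → Tree
  forget (pnode cs) = node (forgetList cs)

  forgetList : List (ℕ × ℕ × PTree) → List Tree
  forgetList []              = []
  forgetList ((_ , _ , c) ∷ cs) = forget c ∷ forgetList cs

-- Nodes are identified by their address: the sequence of ports taken
-- from the root (stored reversed, most recent port first).

Addr : Set
Addr = List ℕ

nodesAt : ℕ → Addr → PTree → List Addr
nodesAt zero    p _          = [ p ]
nodesAt (suc i) p (pnode cs) = concatMap (λ e → nodesAt i (proj₁ e ∷ p) (proj₂ (proj₂ e))) cs

insertByPort : ℕ × ℕ × PTree → List (ℕ × ℕ × PTree) → List (ℕ × ℕ × PTree)
insertByPort e [] = e ∷ []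
insertByPort e (x ∷ xs) = if proj₁ e ≤ᵇ proj₁ x then e ∷ x ∷ xs else x ∷ insertByPort e xs

sortByPort : List (ℕ × ℕ × PTree) → List (ℕ × ℕ × PTree)
sortByPort []       = []
sortByPort (e ∷ es) = insertByPort e (sortByPort es)

-- dfs h p t : the sequence of positions (one per edge traversal) of
-- DFS_h started at the node with address p, children in increasing port
-- order, ending back at p.
dfs : ℕ → Addr → PTree → List Addr
dfs zero    p _          = []
dfs (suc r) p (pnode cs) =
  concatMap (λ e → (proj₁ e ∷ p) ∷ (dfs r (proj₁ e ∷ p) (proj₂ (proj₂ e)) ++ [ p ])) (sortByPort cs)

-- k := min { i ≥ h+1 : L_{h+1}^i ≥ L_1^h }.  The search range
-- h+1 … h+1+height t suffices (L_{h+1}^i is constant for i ≥ height t).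
-- Convention if no such i exists: k := height t.
searchK : Tree → ℕ → ℕ → ℕ → ℕ
searchK t h i fuel with L t 1 h ≤ᵇ L t (suc h) i
... | true  = i
searchK t h i zero     | false = height t
searchK t h i (suc f)  | false = searchK t h (suc i) f

kOf : Tree → ℕ → ℕ
kOf t h = searchK t h (suc h) (height t)

nextH : Tree → ℕ → ℕ
nextH t h =
  if (3 * L t 1 h ≤ᵇ L t (suc h) (kOf t h)) ∧ (suc (suc h) ≤ᵇ kOf t h)
  then kOf t h ∸ 1 else kOf t h

hSeq : Tree → ℕ → ℕ
hSeq t zero    = 1
hSeq t (suc j) = nextH t (hSeq t j)

walk : Tree → PTree → ℕ → List Addr
walk t T m = concatMap (λ j → dfs (hSeq t j) [] T) (upTo m)

{-# OPTIONS --safe #-}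
module Submission where

-- Iteration j of the algorithm is DFS_{h_j}, a walk of length 2 L_1^{h_j} that visits level d once
-- h_j ≥ d, so it suffices that Σ_{i ≤ j} L_1^{h_i} ≤ 6 L_1^d for the first j with h_j ≥ d.
-- In prefix sums the rule reads: k is the first depth with L_1^k ≥ 2 L_1^h, and the algorithm
-- steps back to k - 1 when moreover L_1^k ≥ 4 L_1^h and k ≥ h + 2.  Call a state balanced when
-- the accumulated cost is at most 2 L_1^h.  A step to k keeps the state balanced because
-- L_1^k ≥ 2 L_1^h.  A step back to k - 1 adds less than 2 L_1^h and leaves a primed state: the
-- accumulated cost is below 4 L_1^h ≤ L_1^k and L_1^k ≥ 2 L_1^{k-1}, so the next step goes to k
-- and restores balance.  When depth d is first reached, the accumulated cost is at most 6 L_1^h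
-- for the last balanced h < d, or at most 2 L_1^d when the new depth is exactly d.

open import Defs
open import Algebra.Properties.CommutativeSemigroup using (interchange)
open import Data.Bool using (true; false)
open import Data.Empty using (⊥-elim)
open import Data.List using (List; []; _∷_; [_]; _++_; map; length; upTo; applyUpTo; concatMap; take)
open import Data.List.Properties
  using (map-upTo; map-cong; map-∘; length-++; ++-identityʳ; upTo-∷ʳ; concatMap-++; take-all)
open import Data.List.Membership.Propositional using (_∈_)
open import Data.List.Membership.Propositional.Properties using (∈-++⁺ˡ)
open import Data.List.Relation.Binary.Permutation.Propositional
  using (_↭_; ↭-refl; ↭-prep; ↭-swap; ↭-trans; ↭-sym)
import Data.List.Relation.Binary.Permutation.Propositional.Properties as ↭
open import Data.List.Relation.Binary.Pointwise using (Pointwise; []; _∷_)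
open import Data.List.Relation.Binary.Subset.Propositional using (_⊆_)
open import Data.List.Relation.Binary.Subset.Propositional.Properties
  using (⊆-trans; ⊆-reflexive-↭; ++⁺; concatMap⁺; xs⊆ys++xs)
open import Data.List.Relation.Unary.All using (All)
import Data.List.Relation.Unary.All as All
open import Data.List.Relation.Unary.Any using (here; there)
open import Data.Maybe using (nothing)
open import Data.Nat
open import Data.Nat.Properties
open import Data.Nat.ListAction using (sum)
open import Data.Nat.ListAction.Properties using (sum-↭)
open import Data.Product using (_×_; _,_; ∃-syntax; proj₁; proj₂)
open import Data.Sum using (_⊎_; inj₁; inj₂)
open import Function using (_∘_)
open import Relation.Binary.PropositionalEquality
  using (_≡_; refl; sym; trans; cong; cong₂; subst; module ≡-Reasoning)
open import Relation.Nullary using (yes; no)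
open import Relation.Nullary.Reflects using (ofʸ; ofⁿ)

-- Sums

sum-map-+ : ∀ {A : Set} (f g : A → ℕ) xs →
  sum (map (λ x → f x + g x) xs) ≡ sum (map f xs) + sum (map g xs)
sum-map-+ f g []       = refl
sum-map-+ f g (x ∷ xs) =
  trans (cong (f x + g x +_) (sum-map-+ f g xs))
        (interchange +-commutativeSemigroup (f x) (g x) _ _)

sum-map-* : ∀ {A : Set} c (f : A → ℕ) xs → sum (map (λ x → c * f x) xs) ≡ c * sum (map f xs)
sum-map-* c f []       = sym (*-zeroʳ c)
sum-map-* c f (x ∷ xs) =
  trans (cong (c * f x +_) (sum-map-* c f xs)) (sym (*-distribˡ-+ c (f x) _))

sum-map-zero : ∀ {A : Set} (xs : List A) → sum (map (λ _ → 0) xs) ≡ 0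
sum-map-zero []       = refl
sum-map-zero (_ ∷ xs) = sum-map-zero xs

sum-map-comm : ∀ {A B : Set} (f : A → B → ℕ) xs ys →
  sum (map (λ x → sum (map (f x) ys)) xs) ≡ sum (map (λ y → sum (map (λ x → f x y) xs)) ys)
sum-map-comm f []       ys = sym (sum-map-zero ys)
sum-map-comm f (x ∷ xs) ys =
  trans (cong (sum (map (f x) ys) +_) (sum-map-comm f xs ys)) (sym (sum-map-+ (f x) _ ys))

sum-upTo-+ : ∀ (f : ℕ → ℕ) m n →
  sum (map f (upTo (m + n))) ≡ sum (map f (upTo m)) + sum (map (λ j → f (m + j)) (upTo n))
sum-upTo-+ f m n = begin
  sum (map f (upTo (m + n)))                                  ≡⟨ cong sum (map-upTo f (m + n)) ⟩
  sum (applyUpTo f (m + n))                                   ≡⟨ sum-applyUpTo-+ f m ⟩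
  sum (applyUpTo f m) + sum (applyUpTo (λ j → f (m + j)) n)   ≡⟨ cong₂ _+_ (cong sum (map-upTo f m))
                                                                           (cong sum (map-upTo _ n)) ⟨
  sum (map f (upTo m)) + sum (map (λ j → f (m + j)) (upTo n)) ∎
  where
  open ≡-Reasoning
  sum-applyUpTo-+ : ∀ (f : ℕ → ℕ) m →
    sum (applyUpTo f (m + n)) ≡ sum (applyUpTo f m) + sum (applyUpTo (λ j → f (m + j)) n)
  sum-applyUpTo-+ f zero    = refl
  sum-applyUpTo-+ f (suc m) =
    trans (cong (f 0 +_) (sum-applyUpTo-+ (f ∘ suc) m)) (sym (+-assoc (f 0) _ _))

sum-upTo-mono : ∀ (f : ℕ → ℕ) {m n} → m ≤ n → sum (map f (upTo m)) ≤ sum (map f (upTo n))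
sum-upTo-mono f {m} {n} m≤n = begin
  sum (map f (upTo m))                                              ≤⟨ m≤m+n _ _ ⟩
  sum (map f (upTo m)) + sum (map (λ j → f (m + j)) (upTo (n ∸ m))) ≡⟨ sum-upTo-+ f m (n ∸ m) ⟨
  sum (map f (upTo (m + (n ∸ m))))                                  ≡⟨ cong (sum ∘ map f ∘ upTo)
                                                                            (m+[n∸m]≡n m≤n) ⟩
  sum (map f (upTo n))                                              ∎
  where open ≤-Reasoning

m≤n⇒m+n≤2*n : ∀ {m n} → m ≤ n → m + n ≤ 2 * n
m≤n⇒m+n≤2*n {n = n} m≤n =
  ≤-trans (+-monoˡ-≤ n m≤n) (≤-reflexive (cong (n +_) (sym (+-identityʳ n))))

m,n≤2*o⇒m+n≤4*o : ∀ o {m n} → m ≤ 2 * o → n ≤ 2 * o → m + n ≤ 4 * o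
m,n≤2*o⇒m+n≤4*o o m≤ n≤ = ≤-trans (+-mono-≤ m≤ n≤) (≤-reflexive (sym (*-distribʳ-+ o 2 2)))

-- Level counts

L-split : ∀ t {a b c} → a ≤ suc b → b ≤ c → L t a c ≡ L t a b + L t (suc b) c
L-split t {a} {b} {c} a≤1+b b≤c = begin
  sum (map f (upTo (suc c ∸ a)))                       ≡⟨ cong (sum ∘ map f ∘ upTo) range ⟩
  sum (map f (upTo (m + (c ∸ b))))                     ≡⟨ sum-upTo-+ f m (c ∸ b) ⟩
  L t a b + sum (map (λ j → f (m + j)) (upTo (c ∸ b))) ≡⟨ cong (λ xs → L t a b + sum xs)
                                                               (map-cong shift (upTo (c ∸ b))) ⟩
  L t a b + L t (suc b) c                              ∎
  where
  open ≡-Reasoning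
  f : ℕ → ℕ
  f j = level (a + j) t
  m : ℕ
  m = suc b ∸ a
  range : suc c ∸ a ≡ m + (c ∸ b)
  range = trans (cong (_∸ a) (sym (m+[n∸m]≡n (s≤s b≤c)))) (+-∸-comm (c ∸ b) a≤1+b)
  shift : ∀ j → f (m + j) ≡ level (suc b + j) t
  shift j = cong (λ i → level i t) (trans (sym (+-assoc a m j)) (cong (_+ j) (m+[n∸m]≡n a≤1+b)))

L-mono : ∀ t a {b c} → b ≤ c → L t a b ≤ L t a c
L-mono t a b≤c = sum-upTo-mono _ (∸-monoˡ-≤ a (s≤s b≤c))

levelList-sum : ∀ i ts → levelList i ts ≡ sum (map (level i) ts)
levelList-sum i []       = refl
levelList-sum i (t ∷ ts) = cong (level i t +_) (levelList-sum i ts)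

L-node : ∀ ts a b → L (node ts) (suc a) (suc b) ≡ sum (map (λ t → L t a b) ts)
L-node ts a b =
  trans (cong sum (map-cong (λ j → levelList-sum (a + j) ts) (upTo (suc b ∸ a))))
        (sum-map-comm (λ j t → level (a + j) t) (upTo (suc b ∸ a)) ts)

mutual
  level-cong : ∀ {t u} → t ≅ u → ∀ i → level i t ≡ level i u
  level-cong _                                 zero    = refl
  level-cong (iso {cs} {es} {ds} cs↭es es≅ds) (suc i) = begin
    levelList i cs          ≡⟨ levelList-sum i cs ⟩
    sum (map (level i) cs)  ≡⟨ sum-↭ (↭.map⁺ (level i) cs↭es) ⟩
    sum (map (level i) es)  ≡⟨ levelList-sum i es ⟨
    levelList i es          ≡⟨ levelList-cong es≅ds i ⟩
    levelList i ds          ∎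
    where open ≡-Reasoning

  levelList-cong : ∀ {es ds} → Pointwise _≅_ es ds → ∀ i → levelList i es ≡ levelList i ds
  levelList-cong []            i = refl
  levelList-cong (e≅d ∷ es≅ds) i = cong₂ _+_ (level-cong e≅d i) (levelList-cong es≅ds i)

L-cong : ∀ {t u} → t ≅ u → ∀ a b → L t a b ≡ L u a b
L-cong t≅u a b = cong sum (map-cong (λ j → level-cong t≅u (a + j)) (upTo (suc b ∸ a)))

tail≥⇒prefix≥ : ∀ t {h k} c → h ≤ k → c * L t 1 h ≤ L t (suc h) k → suc c * L t 1 h ≤ L t 1 k
tail≥⇒prefix≥ t {h} c h≤k big =
  subst (suc c * L t 1 h ≤_) (sym (L-split t (s≤s z≤n) h≤k)) (+-monoʳ-≤ (L t 1 h) big)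

tail<⇒prefix< : ∀ t {h k} c → h ≤ k → L t (suc h) k < c * L t 1 h → L t 1 k < suc c * L t 1 h
tail<⇒prefix< t {h} c h≤k small =
  subst (_< suc c * L t 1 h) (sym (L-split t (s≤s z≤n) h≤k)) (+-monoʳ-< (L t 1 h) small)

-- The depth chosen by the algorithm

data SearchK (t : Tree) (h i f : ℕ) : ℕ → Set where
  found    : ∀ {k} → i ≤ k → L t 1 h ≤ L t (suc h) k →
             (∀ {j} → i ≤ j → j < k → L t (suc h) j < L t 1 h) → SearchK t h i f k
  notFound : L t (suc h) (i + f) < L t 1 h → SearchK t h i f (height t)

searchK-view : ∀ t h i f → SearchK t h i f (searchK t h i f)
searchK-view t h i f with L t 1 h ≤ᵇ L t (suc h) i | ≤ᵇ-reflects-≤ (L t 1 h) (L t (suc h) i)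
... | true  | ofʸ hit = found ≤-refl hit (λ i≤j j<i → ⊥-elim (<⇒≱ j<i i≤j))
searchK-view t h i zero    | false | ofⁿ miss =
  notFound (subst (λ n → L t (suc h) n < L t 1 h) (sym (+-identityʳ i)) (≰⇒> miss))
searchK-view t h i (suc f) | false | ofⁿ miss
    with searchK t h (suc i) f | searchK-view t h (suc i) f
... | _ | notFound beyond =
  notFound (subst (λ n → L t (suc h) n < L t 1 h) (sym (+-suc i f)) beyond)
... | _ | found {k} i<k hit below = found (<⇒≤ i<k) hit below′
  where
  below′ : ∀ {j} → i ≤ j → j < k → L t (suc h) j < L t 1 h
  below′ {j} i≤j j<k with i ≟ j
  ... | yes refl = ≰⇒> miss
  ... | no  i≢j  = below (≤∧≢⇒< i≤j i≢j) j<k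

data FirstDoubling (t : Tree) (h : ℕ) : ℕ → Set where
  first : ∀ {k} → h < k → 2 * L t 1 h ≤ L t 1 k →
          (∀ {j} → h < j → j < k → L t 1 j < 2 * L t 1 h) → FirstDoubling t h k
  none  : L t 1 (height t) < 2 * L t 1 h → FirstDoubling t h (height t)

kOf-view : ∀ t {h} → h ≤ height t → FirstDoubling t h (kOf t h)
kOf-view t {h} h≤ht with kOf t h | searchK-view t h (suc h) (height t)
... | _ | found h<k hit below =
  first h<k (tail≥⇒prefix≥ t 1 (<⇒≤ h<k) (≤-trans (≤-reflexive (*-identityˡ _)) hit))
        (λ h<j j<k → tail<⇒prefix< t 1 (<⇒≤ h<j)
                       (≤-trans (below h<j j<k) (≤-reflexive (sym (*-identityˡ _)))))
... | _ | notFound beyond =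
  none (tail<⇒prefix< t 1 h≤ht (≤-trans short (≤-reflexive (sym (*-identityˡ _)))))
  where short = ≤-<-trans (L-mono t (suc h) (m≤n+m (height t) (suc h))) beyond

data Iteration (t : Tree) (h : ℕ) : ℕ → Set where
  exhausted : L t 1 (height t) < 2 * L t 1 h → Iteration t h (height t)
  reached   : ∀ {k} → h < k → 2 * L t 1 h ≤ L t 1 k →
              (∀ {j} → h < j → j < k → L t 1 j < 2 * L t 1 h) →
              L t 1 k < 4 * L t 1 h ⊎ k ≡ suc h → Iteration t h k
  overshot  : ∀ {k} → h < k → L t 1 k < 2 * L t 1 h → 4 * L t 1 h ≤ L t 1 (suc k) →
              Iteration t h k

nextH-view : ∀ t {h} → h ≤ height t → Iteration t h (nextH t h)
nextH-view t {h} h≤ht with kOf t h | kOf-view t h≤ht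
nextH-view t {h} h≤ht | _ | none short
    with 3 * L t 1 h ≤ᵇ L t (suc h) (height t)
       | ≤ᵇ-reflects-≤ (3 * L t 1 h) (L t (suc h) (height t))
... | true  | ofʸ big =
  ⊥-elim (<⇒≱ short (≤-trans (*-monoˡ-≤ (L t 1 h) (m≤m+n 2 2)) (tail≥⇒prefix≥ t 3 h≤ht big)))
... | false | _       = exhausted short
nextH-view t {h} h≤ht | k | first h<k doubled least
    with 3 * L t 1 h ≤ᵇ L t (suc h) k | ≤ᵇ-reflects-≤ (3 * L t 1 h) (L t (suc h) k)
       | suc (suc h) ≤ᵇ k             | ≤ᵇ-reflects-≤ (suc (suc h)) k
... | true  | ofʸ big   | true  | ofʸ (s≤s h<k-1) =
  overshot h<k-1 (least h<k-1 ≤-refl) (tail≥⇒prefix≥ t 3 (m≤n⇒m≤1+n (<⇒≤ h<k-1)) big)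
... | true  | ofʸ _     | false | ofⁿ near =
  reached h<k doubled least (inj₂ (≤-antisym (≤-pred (≰⇒> near)) h<k))
... | false | ofⁿ small | _     | _        =
  reached h<k doubled least (inj₁ (tail<⇒prefix< t 3 (<⇒≤ h<k) (≰⇒> small)))

nextH-increasing : ∀ t {h} → h < height t → h < nextH t h
nextH-increasing t {h} h<ht with nextH t h | nextH-view t (<⇒≤ h<ht)
... | _ | exhausted _       = h<ht
... | _ | reached h<k _ _ _ = h<k
... | _ | overshot h<k _ _  = h<k

nextH-doubling : ∀ t {h} → h < height t → 2 * L t 1 h ≤ L t 1 (suc h) → nextH t h ≡ suc h
nextH-doubling t {h} h<ht grow with nextH t h | nextH-view t (<⇒≤ h<ht)
... | _ | exhausted short      = ⊥-elim (<⇒≱ short (≤-trans grow (L-mono t 1 h<ht)))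
... | _ | overshot h<k short _ = ⊥-elim (<⇒≱ short (≤-trans grow (L-mono t 1 h<k)))
... | _ | reached h<k _ least _ with m≤n⇒m<n∨m≡n h<k
...   | inj₁ 1+h<k = ⊥-elim (<⇒≱ (least ≤-refl 1+h<k) grow)
...   | inj₂ 1+h≡k = sym 1+h≡k

-- The walk

insertByPort-↭ : ∀ e es → insertByPort e es ↭ e ∷ es
insertByPort-↭ e []       = ↭-refl
insertByPort-↭ e (x ∷ xs) with proj₁ e ≤ᵇ proj₁ x
... | true  = ↭-refl
... | false = ↭-trans (↭-prep x (insertByPort-↭ e xs)) (↭-swap x e ↭-refl)

sortByPort-↭ : ∀ es → sortByPort es ↭ es
sortByPort-↭ []       = ↭-refl
sortByPort-↭ (e ∷ es) = ↭-trans (insertByPort-↭ e (sortByPort es)) (↭-prep e (sortByPort-↭ es))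

length-concatMap : ∀ {A B : Set} (f : A → List B) xs →
  length (concatMap f xs) ≡ sum (map (length ∘ f) xs)
length-concatMap f []       = refl
length-concatMap f (x ∷ xs) =
  trans (length-++ (f x)) (cong (length (f x) +_) (length-concatMap f xs))

concatMap-mono : ∀ {A B : Set} {f g : A → List B} → (∀ x → f x ⊆ g x) →
  ∀ xs → concatMap f xs ⊆ concatMap g xs
concatMap-mono f⊆g []       = λ ()
concatMap-mono f⊆g (x ∷ xs) = ++⁺ (f⊆g x) (concatMap-mono f⊆g xs)

forgetList-map : ∀ es → forgetList es ≡ map (forget ∘ proj₂ ∘ proj₂) es
forgetList-map []       = refl
forgetList-map (e ∷ es) = cong (forget (proj₂ (proj₂ e)) ∷_) (forgetList-map es)

length-dfs : ∀ h p T → length (dfs h p T) ≡ 2 * L (forget T) 1 h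
length-dfs zero    p T          = refl
length-dfs (suc h) p (pnode es) = begin
  length (concatMap visit (sortByPort es))       ≡⟨ length-concatMap visit (sortByPort es) ⟩
  sum (map (length ∘ visit) (sortByPort es))     ≡⟨ sum-↭ (↭.map⁺ (length ∘ visit) (sortByPort-↭ es)) ⟩
  sum (map (length ∘ visit) es)                  ≡⟨ cong sum (map-cong length-visit es) ⟩
  sum (map (λ e → 2 * L (subtree e) 0 h) es)     ≡⟨ sum-map-* 2 (λ e → L (subtree e) 0 h) es ⟩
  2 * sum (map (λ e → L (subtree e) 0 h) es)     ≡⟨ cong (λ ts → 2 * sum ts) (map-∘ es) ⟩
  2 * sum (map (λ t → L t 0 h) (map subtree es)) ≡⟨ cong (λ ts → 2 * sum (map (λ t → L t 0 h) ts))
                                                         (forgetList-map es) ⟨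
  2 * sum (map (λ t → L t 0 h) (forgetList es))  ≡⟨ cong (2 *_) (L-node (forgetList es) 0 h) ⟨
  2 * L (forget (pnode es)) 1 (suc h)            ∎
  where
  open ≡-Reasoning
  subtree : ℕ × ℕ × PTree → Tree
  subtree = forget ∘ proj₂ ∘ proj₂
  visit : ℕ × ℕ × PTree → List Addr
  visit (q , _ , c) = (q ∷ p) ∷ (dfs h (q ∷ p) c ++ [ p ])
  length-visit : ∀ e → length (visit e) ≡ 2 * L (subtree e) 0 h
  length-visit (q , _ , c) = begin
    suc (length (dfs h (q ∷ p) c ++ [ p ])) ≡⟨ cong suc (length-++ (dfs h (q ∷ p) c)) ⟩
    suc (length (dfs h (q ∷ p) c) + 1)      ≡⟨ cong (λ n → suc (n + 1)) (length-dfs h (q ∷ p) c) ⟩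
    suc (2 * L (forget c) 1 h + 1)          ≡⟨ cong suc (+-comm _ 1) ⟩
    2 + 2 * L (forget c) 1 h                ≡⟨ *-suc 2 _ ⟨
    2 * suc (L (forget c) 1 h)              ≡⟨ cong (2 *_) (L-split (forget c) {c = h} z≤n z≤n) ⟨
    2 * L (forget c) 0 h                    ∎

nodesAt⊆dfs : ∀ {d h} p T → 1 ≤ d → d ≤ h → nodesAt d p T ⊆ dfs h p T
nodesAt⊆dfs {suc d} {suc h} p (pnode es) _ (s≤s d≤h) =
  ⊆-trans (concatMap-mono (below d≤h) es)
          (concatMap⁺ _ (⊆-reflexive-↭ (↭-sym (sortByPort-↭ es))))
  where
  below : ∀ {d} → d ≤ h → ∀ e → nodesAt d (proj₁ e ∷ p) (proj₂ (proj₂ e)) ⊆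
          (proj₁ e ∷ p) ∷ (dfs h (proj₁ e ∷ p) (proj₂ (proj₂ e)) ++ [ p ])
  below {zero}  _   _ (here refl) = here refl
  below {suc d} d≤h e v∈          = there (∈-++⁺ˡ (nodesAt⊆dfs _ _ (s≤s z≤n) d≤h v∈))

walk-suc : ∀ t T m → walk t T (suc m) ≡ walk t T m ++ dfs (hSeq t m) [] T
walk-suc t T m = begin
  concatMap iteration (upTo (suc m))    ≡⟨ cong (concatMap iteration) (upTo-∷ʳ m) ⟨
  concatMap iteration (upTo m ++ [ m ]) ≡⟨ concatMap-++ iteration (upTo m) [ m ] ⟩
  walk t T m ++ (iteration m ++ [])     ≡⟨ cong (walk t T m ++_) (++-identityʳ (iteration m)) ⟩
  walk t T m ++ iteration m             ∎
  where
  open ≡-Reasoning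
  iteration : ℕ → List Addr
  iteration j = dfs (hSeq t j) [] T

dfs⊆walk : ∀ t T m → dfs (hSeq t m) [] T ⊆ walk t T (suc m)
dfs⊆walk t T m v∈ = subst (_ ∈_) (sym (walk-suc t T m)) (xs⊆ys++xs _ (walk t T m) v∈)

cost : Tree → ℕ → ℕ
cost t zero    = 0
cost t (suc m) = cost t m + L t 1 (hSeq t m)

length-walk : ∀ {t T} → forget T ≅ t → ∀ m → length (walk t T m) ≡ 2 * cost t m
length-walk         T≅t zero    = refl
length-walk {t} {T} T≅t (suc m) = begin
  length (walk t T (suc m))                          ≡⟨ cong length (walk-suc t T m) ⟩
  length (walk t T m ++ dfs h [] T)                  ≡⟨ length-++ (walk t T m) ⟩
  length (walk t T m) + length (dfs h [] T)          ≡⟨ cong₂ _+_ (length-walk T≅t m) (length-dfs h [] T) ⟩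
  2 * cost t m + 2 * L (forget T) 1 h                ≡⟨ cong (λ n → 2 * cost t m + 2 * n) (L-cong T≅t 1 h) ⟩
  2 * cost t m + 2 * L t 1 h                         ≡⟨ *-distribˡ-+ 2 (cost t m) (L t 1 h) ⟨
  2 * cost t (suc m)                                 ∎
  where
  open ≡-Reasoning
  h : ℕ
  h = hSeq t m

-- Cost of the iterations

module CostAnalysis (t : Tree) {d : ℕ} (d≤ht : d ≤ height t) where

  S : ℕ → ℕ
  S = L t 1

  Done : ℕ → ℕ → Set
  Done h σ = d ≤ h × σ ≤ 6 * S d

  data Phase (h σ : ℕ) : Set where
    balanced : σ ≤ 2 * S h → Phase h σ
    primed   : σ ≤ S (suc h) → 2 * S h ≤ S (suc h) → Phase h σ

  Outcome : ℕ → ℕ → Set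
  Outcome h σ = Done h σ ⊎ (h < d × Phase h σ)

  done-from : ∀ {h k σ} → h ≤ d → d ≤ k → σ ≤ 6 * S h → Done k σ
  done-from h≤d d≤k σ≤ = d≤k , ≤-trans σ≤ (*-monoʳ-≤ 6 (L-mono t 1 h≤d))

  done-from-4* : ∀ {h k σ} → h ≤ d → d ≤ k → σ ≤ 4 * S h → Done k σ
  done-from-4* {h} h≤d d≤k σ≤ = done-from h≤d d≤k (≤-trans σ≤ (*-monoˡ-≤ (S h) (m≤m+n 4 2)))

  settle : ∀ {k σ} → k ≤ d → σ ≤ 2 * S k → Outcome k σ
  settle {k} k≤d σ≤ with k <? d
  ... | yes k<d = inj₂ (k<d , balanced σ≤)
  ... | no  k≮d with ≤-antisym k≤d (≮⇒≥ k≮d)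
  ...   | refl = inj₁ (≤-refl , ≤-trans σ≤ (*-monoˡ-≤ (S k) (m≤m+n 2 4)))

  balanced-step : ∀ {h k σ} → h < d → σ ≤ 2 * S h → Iteration t h k → Outcome k (σ + S k)
  balanced-step {h} h<d σ≤ (exhausted short) =
    inj₁ (done-from-4* (<⇒≤ h<d) d≤ht (m,n≤2*o⇒m+n≤4*o (S h) σ≤ (<⇒≤ short)))
  balanced-step {h} {k} h<d σ≤ (reached _ doubled _ (inj₁ small)) with d ≤? k
  ... | yes d≤k = inj₁ (done-from (<⇒≤ h<d) d≤k
                         (≤-trans (+-mono-≤ σ≤ (<⇒≤ small)) (≤-reflexive (sym (*-distribʳ-+ (S h) 2 4)))))
  ... | no  d≰k = inj₂ (≰⇒> d≰k , balanced (m≤n⇒m+n≤2*n (≤-trans σ≤ doubled)))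
  balanced-step h<d σ≤ (reached _ doubled _ (inj₂ refl)) =
    settle h<d (m≤n⇒m+n≤2*n (≤-trans σ≤ doubled))
  balanced-step {h} {k} h<d σ≤ (overshot _ short big) with d ≤? k
  ... | yes d≤k = inj₁ (done-from-4* (<⇒≤ h<d) d≤k (m,n≤2*o⇒m+n≤4*o (S h) σ≤ (<⇒≤ short)))
  ... | no  d≰k = inj₂ (≰⇒> d≰k , primed (≤-trans (m,n≤2*o⇒m+n≤4*o (S h) σ≤ (<⇒≤ short)) big)
                                          (≤-trans 2*Sk≤4*Sh big))
    where
    2*Sk≤4*Sh : 2 * S k ≤ 4 * S h
    2*Sk≤4*Sh = ≤-trans (*-monoʳ-≤ 2 (<⇒≤ short)) (≤-reflexive (sym (*-assoc 2 2 (S h))))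

  step : ∀ {h σ} → h < d → Phase h σ → Outcome (nextH t h) (σ + S (nextH t h))
  step h<d (balanced σ≤)    = balanced-step h<d σ≤ (nextH-view t (≤-trans (<⇒≤ h<d) d≤ht))
  step h<d (primed σ≤ grow) rewrite nextH-doubling t (<-≤-trans h<d d≤ht) grow =
    settle h<d (m≤n⇒m+n≤2*n σ≤)

  run : ∀ f j → d ≤ f + hSeq t j → hSeq t j < d → Phase (hSeq t j) (cost t (suc j)) →
        ∃[ m ] Done (hSeq t m) (cost t (suc m))
  run zero    j d≤ h<d _     = ⊥-elim (<⇒≱ h<d d≤)
  run (suc f) j d≤ h<d phase with step h<d phase
  ... | inj₁ done            = suc j , done
  ... | inj₂ (h′<d , phase′) = run f (suc j) d≤′ h′<d phase′
    where
    d≤′ : d ≤ f + hSeq t (suc j)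
    d≤′ = ≤-trans d≤ (≤-trans (≤-reflexive (sym (+-suc f _)))
                              (+-monoʳ-≤ f (nextH-increasing t (<-≤-trans h<d d≤ht))))

  reach-depth : 1 ≤ d → ∃[ m ] Done (hSeq t m) (cost t (suc m))
  reach-depth 1≤d with settle 1≤d (m≤n*m (S 1) 2)
  ... | inj₁ done          = 0 , done
  ... | inj₂ (1<d , phase) = run d 0 (m≤m+n d 1) 1<d phase

lemma2p2 : (Tstar : Tree) (T : PTree) → Valid nothing T → forget T ≅ Tstar →
    (d : ℕ) → 1 ≤ d → d ≤ height Tstar →
    ∃[ m ] ∃[ n ] (n ≤ 16 * L (forget T) 1 d ×
      All (λ v → v ∈ take n (walk Tstar T m)) (nodesAt d [] T))
lemma2p2 Tstar T _ T≅Tstar d 1≤d d≤ht with CostAnalysis.reach-depth Tstar d≤ht 1≤d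
... | m , d≤h , cost≤ = suc m , length W , length-bound , All.tabulate covered
  where
  W : List Addr
  W = walk Tstar T (suc m)
  length-bound : length W ≤ 16 * L (forget T) 1 d
  length-bound = begin
    length W               ≡⟨ length-walk T≅Tstar (suc m) ⟩
    2 * cost Tstar (suc m) ≤⟨ *-monoʳ-≤ 2 cost≤ ⟩
    2 * (6 * L Tstar 1 d)  ≡⟨ *-assoc 2 6 (L Tstar 1 d) ⟨
    12 * L Tstar 1 d       ≤⟨ *-monoˡ-≤ (L Tstar 1 d) (m≤m+n 12 4) ⟩
    16 * L Tstar 1 d       ≡⟨ cong (16 *_) (L-cong T≅Tstar 1 d) ⟨
    16 * L (forget T) 1 d  ∎
    where open ≤-Reasoning
  covered : ∀ {v} → v ∈ nodesAt d [] T → v ∈ take (length W) W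
  covered v∈ = subst (_ ∈_) (sym (take-all (length W) W ≤-refl))
                     (dfs⊆walk Tstar T m (nodesAt⊆dfs [] T 1≤d d≤h v∈))
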